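{- An integer $x$ is a $\tau_6$-atom if and only if $x$ is a $\tau_2$-atom or a $\tau_3$-atom.
   Context: For a positive integer $n$ and integers $x,y$, write $x\,\tau_n\,y$ if $x\equiv y \pmod n$. For a nonzero nonunit integer $x$, a $\tau_n$-factorization of $x$ is an expression $x=\lambda a_1a_2\cdots a_k$ with $\lambda\in\{1,-1\}$, each $a_i$ a nonzero nonunit integer (i.e. $a_i\neq 0,\pm1$), and $a_i\equiv a_j \pmod n$ for all $i,j$; it is proper if $k>1$. A nonzero nonunit integer $x$ is a $\tau_n$-atom if it has no proper $\tau_n$-factorization. -}

module Defs where

open import Data.Nat using (ℕ) renaming (_≤_ to _≤ℕ_)
open import Data.Integer using (ℤ; +_; -[1+_]; _-_; _*_; ∣_∣)
open import Data.Integer.Divisibility using (_∣_)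
open import Data.List using (List; length; foldr)
open import Data.List.Relation.Unary.All using (All)
open import Data.Product using (Σ; _×_; ∃)
open import Data.Sum using (_⊎_)
open import Relation.Binary.PropositionalEquality using (_≡_; _≢_)
open import Relation.Nullary using (¬_)

prodℤ : List ℤ → ℤ
prodℤ = foldr _*_ (+ 1)

_τ[_]_ : ℤ → ℕ → ℤ → Set
x τ[ n ] y = (+ n) ∣ (x - y)

NonzeroNonunit : ℤ → Set
NonzeroNonunit x = (x ≢ + 0) × (x ≢ + 1) × (x ≢ -[1+ 0 ])

IsSign : ℤ → Set
IsSign s = (s ≡ + 1) ⊎ (s ≡ -[1+ 0 ])

PairwiseTau : ℕ → List ℤ → Set
PairwiseTau n as = All (λ a → All (λ b → a τ[ n ] b) as) as

IsTauFactorization : ℕ → ℤ → ℤ → List ℤ → Set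
IsTauFactorization n x s as =
  IsSign s × 1 ≤ℕ length as × All NonzeroNonunit as × PairwiseTau n as
  × (x ≡ s * prodℤ as)

HasProperTauFactorization : ℕ → ℤ → Set
HasProperTauFactorization n x =
  Σ ℤ λ s → Σ (List ℤ) λ as → IsTauFactorization n x s as × 2 ≤ℕ length as

IsTauAtom : ℕ → ℤ → Set
IsTauAtom n x = NonzeroNonunit x × ¬ HasProperTauFactorization n x

module Submission where

-- Every τ₆-factorization is also a τ₂- and a
-- τ₃-factorization, so τ₂- and τ₃-atoms are τ₆-atoms.  Conversely let x be
-- a τ₆-atom and n = ∣x∣.
--   * If a prime p divides n exactly once (p ∥ n), x is a τ_p-atom: the
--     factors of a τ_p-factorization are either all divisible by p, which
--     forces p² ∣ n as soon as there are two of them, or none is, which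
--     forces p ∤ n.  This settles the cases 2 ∥ n and 3 ∥ n.
--   * Otherwise n is not composite, hence x has no proper factorization at
--     all and is a τ₂-atom.  Indeed a composite n with 2 ∦ n and 3 ∦ n
--     splits as n = a·b with a, b ≥ 2, 2 ∣ a ⇔ 2 ∣ b and 3 ∣ a ⇔ 3 ∣ b
--     (take a = 6, 2, 3 or any proper divisor, according to 4 ∣ n and 9 ∣ n).
--     Such a, b satisfy a ≡ ±b (mod 6): modulo 2 they agree, modulo 3 the
--     only nonzero classes are ±1, and the congruences glue by the Chinese
--     remainder theorem.  Then x = ±a·(±b) is a proper τ₆-factorization.

open import Defs
open import Data.Integer using (ℤ)
open import Data.Sum using (_⊎_)
open import Function.Bundles using (_⇔_)

open import Data.Nat as ℕ using (ℕ; zero; suc; z≤n; s≤s; _≤_; _<_)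
import Data.Nat.Properties as ℕP
open import Data.Nat.Divisibility as ℕD using (divides; _∣?_; ∣-trans)
open import Data.Nat.LCM using (lcm; lcm-least)
open import Data.Nat.Primality using (Prime; Composite; composite⇒nonZero; prime[2]; prime?; euclidsLemma; ¬prime[1])
open import Data.Integer as ℤ using (+_; -[1+_]; _-_; _*_; ∣_∣; -_; 0ℤ; 1ℤ; -1ℤ; _%ℕ_; _/ℕ_)
import Data.Integer.Properties as ℤP
open import Data.Integer.DivMod using (n%ℕd<d; a≡a%ℕn+[a/ℕn]*n)
import Data.Integer.Divisibility.Signed as Signed
open import Data.Integer.Tactic.RingSolver using (solve-∀)
open import Data.List using (List; []; _∷_)
open import Data.List.Relation.Unary.All as All using (All; []; _∷_)
open import Data.Product using (Σ; _×_; _,_)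
open import Data.Sum using (inj₁; inj₂; [_,_]′)
open import Data.Empty using (⊥-elim)
open import Function.Base using (_∘_; const)
open import Function.Bundles using (mk⇔; Equivalence)
import Function.Properties.Equivalence as ⇔
open import Relation.Nullary using (¬_; Dec; yes; no; _×-dec_; ¬?)
open import Relation.Nullary.Decidable using (from-yes; from-no)
open import Relation.Binary.PropositionalEquality

open Equivalence using (to; from)

-- The relation τ_n, wrapped in a record so that the integers it relates can
-- be inferred from a proof (the defining divisibility ∣ i - j ∣ hides them).
infix 4 _≡_[mod_]
record _≡_[mod_] (i j : ℤ) (n : ℕ) : Set where
  constructor mod
  field τ : i τ[ n ] j

open _≡_[mod_] using (τ)

mod-refl : ∀ {n} i → i ≡ i [mod n ]
mod-refl {n} i = mod (subst (n ℕD.∣_) (sym (cong ∣_∣ (ℤP.+-inverseʳ i))) (n ℕD.∣0))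

mod-sym : ∀ {n i j} → i ≡ j [mod n ] → j ≡ i [mod n ]
mod-sym {n} {i} {j} (mod ij) = mod (subst (n ℕD.∣_) (ℤP.∣i-j∣≡∣j-i∣ i j) ij)

mod-trans : ∀ {n i j k} → i ≡ j [mod n ] → j ≡ k [mod n ] → i ≡ k [mod n ]
mod-trans {n} {i} {j} {k} (mod ij) (mod jk) = mod (Signed.∣⇒∣ᵤ {+ n} {i - k}
  (subst (+ n Signed.∣_) (telescope i j k)
    (Signed.∣m∣n⇒∣m+n (Signed.∣ᵤ⇒∣ {+ n} {i - j} ij) (Signed.∣ᵤ⇒∣ {+ n} {j - k} jk))))
  where
  telescope : ∀ a b c → (a - b) ℤ.+ (b - c) ≡ a - c
  telescope = solve-∀

mod-neg : ∀ {n i j} → i ≡ j [mod n ] → - i ≡ - j [mod n ]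
mod-neg {n} {i} {j} (mod ij) =
  mod (subst (n ℕD.∣_) (sym (trans (cong ∣_∣ (negate i j)) (ℤP.∣-i∣≡∣i∣ (i - j)))) ij)
  where
  negate : ∀ a b → - a - - b ≡ - (a - b)
  negate = solve-∀

mod2-neg : ∀ i → i ≡ - i [mod 2 ]
mod2-neg i = mod (Signed.∣⇒∣ᵤ {+ 2} {i - - i}
  (subst (+ 2 Signed.∣_) (sym (double i)) (Signed.∣m⇒∣m*n i (Signed.∣-refl {+ 2}))))
  where
  double : ∀ a → a - - a ≡ + 2 * a
  double = solve-∀

mod-residue : ∀ i n .{{_ : ℕ.NonZero n}} → i ≡ + (i %ℕ n) [mod n ]
mod-residue i n = mod (Signed.∣⇒∣ᵤ {+ n} {i - + r} (Signed.divides q (begin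
  i - + r                    ≡⟨ cong (_- + r) (a≡a%ℕn+[a/ℕn]*n i n) ⟩
  (+ r ℤ.+ q * + n) - + r    ≡⟨ cancel (+ r) q (+ n) ⟩
  q * + n                    ∎)))
  where
  open ≡-Reasoning
  r : ℕ
  r = i %ℕ n
  q : ℤ
  q = i /ℕ n
  cancel : ∀ a b c → (a ℤ.+ b * c) - a ≡ b * c
  cancel = solve-∀

mod-lcm : ∀ {m n i j} → i ≡ j [mod m ] → i ≡ j [mod n ] → i ≡ j [mod lcm m n ]
mod-lcm (mod i≡j) (mod i≡j′) = mod (lcm-least i≡j i≡j′)

∣abs⇔mod0 : ∀ p i → p ℕD.∣ ∣ i ∣ ⇔ i ≡ 0ℤ [mod p ]
∣abs⇔mod0 p i = mk⇔ (mod ∘ subst (p ℕD.∣_) (sym i-0)) (subst (p ℕD.∣_) i-0 ∘ τ)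
  where
  i-0 : ∣ i - 0ℤ ∣ ≡ ∣ i ∣
  i-0 = cong ∣_∣ (ℤP.+-identityʳ i)

mod-resp-∣ : ∀ {q a b} → a ≡ b [mod q ] → q ℕD.∣ ∣ a ∣ → q ℕD.∣ ∣ b ∣
mod-resp-∣ {q} {a} {b} a≡b q∣a =
  from (∣abs⇔mod0 q b) (mod-trans (mod-sym a≡b) (to (∣abs⇔mod0 q a) q∣a))

mod2-classes : ∀ i → i ≡ 0ℤ [mod 2 ] ⊎ i ≡ 1ℤ [mod 2 ]
mod2-classes i with i %ℕ 2 | n%ℕd<d i 2 | mod-residue i 2
... | 0 | _ | i≡0 = inj₁ i≡0
... | 1 | _ | i≡1 = inj₂ i≡1
... | suc (suc _) | s≤s (s≤s ()) | _

mod3-classes : ∀ i → i ≡ 0ℤ [mod 3 ] ⊎ i ≡ 1ℤ [mod 3 ] ⊎ i ≡ -1ℤ [mod 3 ]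
mod3-classes i with i %ℕ 3 | n%ℕd<d i 3 | mod-residue i 3
... | 0 | _ | i≡0 = inj₁ i≡0
... | 1 | _ | i≡1 = inj₂ (inj₁ i≡1)
... | 2 | _ | i≡2 = inj₂ (inj₂ (mod-trans i≡2 (mod (from-yes (3 ∣? 3)))))
... | suc (suc (suc _)) | s≤s (s≤s (s≤s ())) | _

mod2-agree : ∀ {i j} → (i ≡ 0ℤ [mod 2 ] ⇔ j ≡ 0ℤ [mod 2 ]) → i ≡ j [mod 2 ]
mod2-agree {i} {j} agree with mod2-classes i | mod2-classes j
... | inj₁ i≡0 | _        = mod-trans i≡0 (mod-sym (to agree i≡0))
... | inj₂ i≡1 | inj₁ j≡0 = ⊥-elim (from-no (2 ∣? 1) (τ (mod-trans (mod-sym i≡1) (from agree j≡0))))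
... | inj₂ i≡1 | inj₂ j≡1 = mod-trans i≡1 (mod-sym j≡1)

-- Integers that are divisible by 3 together are congruent up to sign
-- modulo 3, since the only nonzero classes are ±1.
mod3-agree : ∀ {i j} → (i ≡ 0ℤ [mod 3 ] ⇔ j ≡ 0ℤ [mod 3 ]) → i ≡ j [mod 3 ] ⊎ i ≡ - j [mod 3 ]
mod3-agree {i} {j} agree with mod3-classes i | mod3-classes j
... | inj₁ i≡0 | _ = inj₁ (mod-trans i≡0 (mod-sym (to agree i≡0)))
... | inj₂ unit | inj₁ j≡0 = ⊥-elim (unit≢0 unit (from agree j≡0))
  where
  unit≢0 : i ≡ 1ℤ [mod 3 ] ⊎ i ≡ -1ℤ [mod 3 ] → ¬ i ≡ 0ℤ [mod 3 ]
  unit≢0 (inj₁ i≡1)  i≡0 = from-no (3 ∣? 1) (τ (mod-trans (mod-sym i≡1) i≡0))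
  unit≢0 (inj₂ i≡-1) i≡0 = from-no (3 ∣? 1) (τ (mod-trans (mod-sym i≡-1) i≡0))
... | inj₂ (inj₁ i≡1)  | inj₂ (inj₁ j≡1)  = inj₁ (mod-trans i≡1 (mod-sym j≡1))
... | inj₂ (inj₁ i≡1)  | inj₂ (inj₂ j≡-1) = inj₂ (mod-trans i≡1 (mod-sym (mod-neg j≡-1)))
... | inj₂ (inj₂ i≡-1) | inj₂ (inj₁ j≡1)  = inj₂ (mod-trans i≡-1 (mod-sym (mod-neg j≡1)))
... | inj₂ (inj₂ i≡-1) | inj₂ (inj₂ j≡-1) = inj₁ (mod-trans i≡-1 (mod-sym j≡-1))

mod6-agree : ∀ {i j} → (i ≡ 0ℤ [mod 2 ] ⇔ j ≡ 0ℤ [mod 2 ]) → (i ≡ 0ℤ [mod 3 ] ⇔ j ≡ 0ℤ [mod 3 ]) →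
             i ≡ j [mod 6 ] ⊎ i ≡ - j [mod 6 ]
mod6-agree {j = j} agree2 agree3 with mod3-agree agree3
... | inj₁ i≡j  = inj₁ (mod-lcm {2} {3} (mod2-agree agree2) i≡j)
... | inj₂ i≡-j = inj₂ (mod-lcm {2} {3} (mod-trans (mod2-agree agree2) (mod2-neg j)) i≡-j)

nonunit⇒2≤∣∣ : ∀ {u} → NonzeroNonunit u → 2 ≤ ∣ u ∣
nonunit⇒2≤∣∣ {+ 0}               (u≢0 , _ , _)  = ⊥-elim (u≢0 refl)
nonunit⇒2≤∣∣ {+ 1}               (_ , u≢1 , _)  = ⊥-elim (u≢1 refl)
nonunit⇒2≤∣∣ {+ suc (suc _)}     _              = s≤s (s≤s z≤n)
nonunit⇒2≤∣∣ { -[1+ 0 ]}         (_ , _ , u≢-1) = ⊥-elim (u≢-1 refl)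
nonunit⇒2≤∣∣ { -[1+ suc _ ]}     _              = s≤s (s≤s z≤n)

2≤∣∣⇒nonunit : ∀ {u} → 2 ≤ ∣ u ∣ → NonzeroNonunit u
2≤∣∣⇒nonunit {+ suc (suc _)}     _ = (λ ()) , (λ ()) , (λ ())
2≤∣∣⇒nonunit { -[1+ suc _ ]}     _ = (λ ()) , (λ ()) , (λ ())
2≤∣∣⇒nonunit {+ 0}               ()
2≤∣∣⇒nonunit {+ 1}               (s≤s ())
2≤∣∣⇒nonunit { -[1+ 0 ]}         (s≤s ())

abs-sign : ∀ {s} y → IsSign s → ∣ s * y ∣ ≡ ∣ y ∣
abs-sign y (inj₁ refl) = cong ∣_∣ (ℤP.*-identityˡ y)
abs-sign y (inj₂ refl) = trans (cong ∣_∣ (ℤP.-1*i≡-i y)) (ℤP.∣-i∣≡∣i∣ y)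

sign-abs : ∀ x → Σ ℤ λ s → IsSign s × x ≡ s * + ∣ x ∣
sign-abs (+ n)    = 1ℤ , inj₁ refl , sym (ℤP.*-identityˡ (+ n))
sign-abs -[1+ n ] = -1ℤ , inj₂ refl , sym (ℤP.-1*i≡-i (+ suc n))

prod-nonzero : ∀ {as} → All NonzeroNonunit as → 1 ≤ ∣ prodℤ as ∣
prod-nonzero []                  = s≤s z≤n
prod-nonzero {a ∷ as} (na ∷ nas) = subst (1 ≤_) (sym (ℤP.abs-* a (prodℤ as)))
  (ℕP.*-mono-≤ {1} {∣ a ∣} (ℕP.≤-trans (s≤s z≤n) (nonunit⇒2≤∣∣ na)) (prod-nonzero nas))

prod-nonunit : ∀ {a as} → All NonzeroNonunit (a ∷ as) → 2 ≤ ∣ prodℤ (a ∷ as) ∣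
prod-nonunit {a} {as} (na ∷ nas) = subst (2 ≤_) (sym (ℤP.abs-* a (prodℤ as)))
  (ℕP.*-mono-≤ {2} {∣ a ∣} {1} (nonunit⇒2≤∣∣ na) (prod-nonzero nas))

abs-factorization : ∀ {x s} a bs → IsSign s → x ≡ s * prodℤ (a ∷ bs) →
                    ∣ x ∣ ≡ ∣ a ∣ ℕ.* ∣ prodℤ bs ∣
abs-factorization {x} {s} a bs sign x≡ = begin
  ∣ x ∣                      ≡⟨ cong ∣_∣ x≡ ⟩
  ∣ s * prodℤ (a ∷ bs) ∣     ≡⟨ abs-sign (prodℤ (a ∷ bs)) sign ⟩
  ∣ a * prodℤ bs ∣           ≡⟨ ℤP.abs-* a (prodℤ bs) ⟩
  ∣ a ∣ ℕ.* ∣ prodℤ bs ∣     ∎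
  where open ≡-Reasoning

-- If ∣x∣ is not composite, x has no proper τ_n-factorization for any n:
-- the first factor of one would be a nontrivial divisor of ∣x∣.
noncomposite⇒no-factorization : ∀ {n} x → ¬ Composite ∣ x ∣ → ¬ HasProperTauFactorization n x
noncomposite⇒no-factorization x _ (_ , [] , (_ , () , _) , _)
noncomposite⇒no-factorization x _ (_ , _ ∷ [] , _ , s≤s ())
noncomposite⇒no-factorization x ¬composite
  (_ , a ∷ b ∷ rest , (sign , _ , na ∷ nbs , _ , x≡) , _) =
  ¬composite (ℕD.hasNonTrivialDivisor {{ℕ.n>1⇒nonTrivial (nonunit⇒2≤∣∣ na)}} a<x a∣x)
  where
  m : ℕ
  m = ∣ prodℤ (b ∷ rest) ∣
  ∣x∣≡ : ∣ x ∣ ≡ ∣ a ∣ ℕ.* m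
  ∣x∣≡ = abs-factorization a (b ∷ rest) sign x≡
  a<x : ∣ a ∣ < ∣ x ∣
  a<x = subst (∣ a ∣ <_) (sym ∣x∣≡)
    (ℕP.m<m*n ∣ a ∣ m {{ℕ.>-nonZero (ℕP.≤-trans (s≤s z≤n) (nonunit⇒2≤∣∣ na))}} (prod-nonunit nbs))
  a∣x : ∣ a ∣ ℕD.∣ ∣ x ∣
  a∣x = subst (∣ a ∣ ℕD.∣_) (sym ∣x∣≡) (ℕD.m∣m*n m)

prime∤prod : ∀ {p} → Prime p → (cs : List ℤ) → All (λ c → ¬ p ℕD.∣ ∣ c ∣) cs →
             ¬ p ℕD.∣ ∣ prodℤ cs ∣
prime∤prod pp [] [] p∣1 with ℕD.∣1⇒≡1 p∣1
... | refl = ¬prime[1] pp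
prime∤prod {p} pp (c ∷ cs) (p∤c ∷ p∤cs) p∣ccs
  with euclidsLemma ∣ c ∣ ∣ prodℤ cs ∣ pp (subst (p ℕD.∣_) (ℤP.abs-* c (prodℤ cs)) p∣ccs)
... | inj₁ p∣c  = p∤c p∣c
... | inj₂ p∣cs = prime∤prod pp cs p∤cs p∣cs

-- If the prime p divides ∣x∣ exactly once, x has no proper τ_p-factorization:
-- the factors are all congruent modulo p, so either p divides two of them
-- (then p² ∣ ∣x∣) or p divides none of them (then p ∤ ∣x∣).
exact-prime⇒no-factorization : ∀ {p} x → Prime p → p ℕD.∣ ∣ x ∣ → ¬ p ℕ.* p ℕD.∣ ∣ x ∣ →
                               ¬ HasProperTauFactorization p x
exact-prime⇒no-factorization x _ _ _ (_ , [] , (_ , () , _) , _)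
exact-prime⇒no-factorization x _ _ _ (_ , _ ∷ [] , _ , s≤s ())
exact-prime⇒no-factorization {p} x pp p∣x p²∤x
  (_ , a ∷ b ∷ rest , (sign , _ , _ , pairwise , x≡) , _) with p ℕD.∣? ∣ a ∣
... | yes p∣a = p²∤x (subst (p ℕ.* p ℕD.∣_) (sym ∣x∣≡) (ℕD.*-pres-∣ p∣a p∣rest))
  where
  ∣x∣≡ : ∣ x ∣ ≡ ∣ a ∣ ℕ.* ∣ prodℤ (b ∷ rest) ∣
  ∣x∣≡ = abs-factorization a (b ∷ rest) sign x≡
  a≡b : a ≡ b [mod p ]
  a≡b = mod (All.head (All.tail (All.head pairwise)))
  p∣rest : p ℕD.∣ ∣ prodℤ (b ∷ rest) ∣
  p∣rest = subst (p ℕD.∣_) (sym (ℤP.abs-* b (prodℤ rest)))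
    (ℕD.∣m⇒∣m*n ∣ prodℤ rest ∣ (mod-resp-∣ a≡b p∣a))
... | no p∤a = prime∤prod pp (a ∷ b ∷ rest) p∤factors
  (subst (p ℕD.∣_) (trans (cong ∣_∣ x≡) (abs-sign (prodℤ (a ∷ b ∷ rest)) sign)) p∣x)
  where
  p∤factors : All (λ c → ¬ p ℕD.∣ ∣ c ∣) (a ∷ b ∷ rest)
  p∤factors = All.map (λ {c} → p∤factor {c}) pairwise
    where
    p∤factor : ∀ {c} → All (c τ[ p ]_) (a ∷ b ∷ rest) → ¬ p ℕD.∣ ∣ c ∣
    p∤factor {c} (c≡a ∷ _) p∣c = p∤a (mod-resp-∣ (mod {c} {a} c≡a) p∣c)

pair-factorization : ∀ {n x} s u v → IsSign s → NonzeroNonunit u → NonzeroNonunit v →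
                     x ≡ s * (u * v) → u ≡ v [mod n ] → HasProperTauFactorization n x
pair-factorization s u v sign nu nv x≡ u≡v =
  s , u ∷ v ∷ [] ,
  (sign , s≤s z≤n , nu ∷ nv ∷ [] ,
   (τ (mod-refl u) ∷ τ u≡v ∷ []) ∷ (τ (mod-sym u≡v) ∷ τ (mod-refl v) ∷ []) ∷ [] ,
   trans x≡ (cong (λ w → s * (u * w)) (sym (ℤP.*-identityʳ v)))) ,
  s≤s (s≤s z≤n)

-- If ∣x∣ = a·b with a, b ≥ 2 and a ≡ ±b (mod n), then x = s·a·b = (-s)·a·(-b),
-- s the sign of x, is a proper τ_n-factorization.
split-factorization : ∀ {n} x a b → ∣ x ∣ ≡ a ℕ.* b → 2 ≤ a → 2 ≤ b →
                      + a ≡ + b [mod n ] ⊎ + a ≡ - + b [mod n ] → HasProperTauFactorization n x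
split-factorization x a b ∣x∣≡ 2≤a 2≤b with sign-abs x
... | s , sign , x≡ = [ pair-factorization s (+ a) (+ b) sign nu-a nu-b x≡s·a·b
                      , pair-factorization (- s) (+ a) (- + b) (neg-sign sign) nu-a nu-[-b]
                          (trans x≡s·a·b (flip-signs s (+ a) (+ b))) ]′
  where
  nu-a : NonzeroNonunit (+ a)
  nu-a = 2≤∣∣⇒nonunit 2≤a
  nu-b : NonzeroNonunit (+ b)
  nu-b = 2≤∣∣⇒nonunit 2≤b
  nu-[-b] : NonzeroNonunit (- + b)
  nu-[-b] = 2≤∣∣⇒nonunit (subst (2 ≤_) (sym (ℤP.∣-i∣≡∣i∣ (+ b))) 2≤b)
  x≡s·a·b : x ≡ s * (+ a * + b)
  x≡s·a·b = trans x≡ (cong (s *_) (trans (cong +_ ∣x∣≡) (ℤP.pos-* a b)))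
  neg-sign : ∀ {t} → IsSign t → IsSign (- t)
  neg-sign (inj₁ refl) = inj₂ refl
  neg-sign (inj₂ refl) = inj₁ refl
  flip-signs : ∀ t u v → t * (u * v) ≡ (- t) * (u * (- v))
  flip-signs = solve-∀

_∥_ : ℕ → ℕ → Set
p ∥ n = p ℕD.∣ n × ¬ p ℕ.* p ℕD.∣ n

_∥?_ : ∀ p n → Dec (p ∥ n)
p ∥? n = (p ∣? n) ×-dec ¬? (p ℕ.* p ∣? n)

record BalancedSplit (n : ℕ) : Set where
  constructor balanced
  field
    {a b}  : ℕ
    n≡a*b  : n ≡ a ℕ.* b
    2≤a    : 2 ≤ a
    2≤b    : 2 ≤ b
    agree2 : 2 ℕD.∣ a ⇔ 2 ℕD.∣ b
    agree3 : 3 ℕD.∣ a ⇔ 3 ℕD.∣ b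

-- A balanced splitting of ∣x∣ yields a proper τ₆-factorization of x, since
-- its factors are congruent up to sign modulo 6.
balanced⇒factorization : ∀ x → BalancedSplit ∣ x ∣ → HasProperTauFactorization 6 x
balanced⇒factorization x (balanced {a} {b} ∣x∣≡ 2≤a 2≤b agree2 agree3) =
  split-factorization x a b ∣x∣≡ 2≤a 2≤b (mod6-agree (in-ℤ agree2) (in-ℤ agree3))
  where
  in-ℤ : ∀ {p} → p ℕD.∣ a ⇔ p ℕD.∣ b → (+ a ≡ 0ℤ [mod p ] ⇔ + b ≡ 0ℤ [mod p ])
  in-ℤ {p} agree = ⇔.trans (⇔.sym (∣abs⇔mod0 p (+ a))) (⇔.trans agree (∣abs⇔mod0 p (+ b)))

both : ∀ {P Q : Set} → P → Q → P ⇔ Q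
both p q = mk⇔ (const q) (const p)

neither : ∀ {P Q : Set} → ¬ P → ¬ Q → P ⇔ Q
neither ¬p ¬q = mk⇔ (⊥-elim ∘ ¬p) (⊥-elim ∘ ¬q)

not-exact⇒square : ∀ {p n} → p ℕD.∣ n → ¬ p ∥ n → p ℕ.* p ℕD.∣ n
not-exact⇒square {p} {n} p∣n ¬p∥n with p ℕ.* p ∣? n
... | yes p²∣n = p²∣n
... | no p²∤n  = ⊥-elim (¬p∥n (p∣n , p²∤n))

square-split : ∀ {d n} → 2 ≤ d → n ≢ 0 → d ℕ.* d ℕD.∣ n →
               Σ ℕ λ b → n ≡ d ℕ.* b × d ℕD.∣ b × 2 ≤ b
square-split _ n≢0 (divides zero n≡0) = ⊥-elim (n≢0 n≡0)
square-split {d} 2≤d _ (divides k@(suc _) n≡) =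
  k ℕ.* d , trans n≡ regroup , ℕD.n∣m*n k , ℕP.≤-trans 2≤d (ℕP.m≤n*m d k)
  where
  regroup : k ℕ.* (d ℕ.* d) ≡ d ℕ.* (k ℕ.* d)
  regroup = trans (sym (ℕP.*-assoc k d d)) (ℕP.*-comm (k ℕ.* d) d)

cofactor≥2 : ∀ {d e n} → n ≢ 0 → d < n → n ≡ e ℕ.* d → 2 ≤ e
cofactor≥2 {e = 0}           n≢0 _   n≡ = ⊥-elim (n≢0 n≡)
cofactor≥2 {d} {e = 1}       _   d<n n≡ =
  ⊥-elim (ℕP.<-irrefl (trans (sym (ℕP.+-identityʳ d)) (sym n≡)) d<n)
cofactor≥2 {e = suc (suc _)} _   _   _  = s≤s (s≤s z≤n)

∤-divisor : ∀ {p m n} → ¬ p ℕD.∣ n → m ℕD.∣ n → ¬ p ℕD.∣ m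
∤-divisor p∤n m∣n p∣m = p∤n (∣-trans p∣m m∣n)

-- A composite n with neither 2 ∥ n nor 3 ∥ n splits in a balanced way:
-- as 6·b if 2 ∣ n and 3 ∣ n (then 36 ∣ n), as 2·b if only 2 ∣ n (then 4 ∣ n),
-- as 3·b if only 3 ∣ n (then 9 ∣ n), and along any proper divisor otherwise.
balanced-split : ∀ n → Composite n → ¬ 2 ∥ n → ¬ 3 ∥ n → BalancedSplit n
balanced-split n composite-n@(ℕD.hasNonTrivialDivisor {d} d<n d∣n@(divides e n≡e*d)) ¬2∥n ¬3∥n =
  by-cases (2 ∣? n) (3 ∣? n)
  where
  n≢0 : n ≢ 0
  n≢0 = ℕ.≢-nonZero⁻¹ n {{composite⇒nonZero composite-n}}

  split-off : ∀ c → 2 ≤ c → c ℕ.* c ℕD.∣ n →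
              (∀ {b} → c ℕD.∣ b → b ℕD.∣ n → (2 ℕD.∣ c ⇔ 2 ℕD.∣ b) × (3 ℕD.∣ c ⇔ 3 ℕD.∣ b)) →
              BalancedSplit n
  split-off c 2≤c c²∣n agree with square-split 2≤c n≢0 c²∣n
  ... | b , n≡c*b , c∣b , 2≤b with agree c∣b (divides c n≡c*b)
  ...   | agree2 , agree3 = balanced n≡c*b 2≤c 2≤b agree2 agree3

  by-cases : Dec (2 ℕD.∣ n) → Dec (3 ℕD.∣ n) → BalancedSplit n
  by-cases (yes 2∣n) (yes 3∣n) = split-off 6 (s≤s (s≤s z≤n))
    (lcm-least {4} {9} (not-exact⇒square 2∣n ¬2∥n) (not-exact⇒square 3∣n ¬3∥n))
    (λ 6∣b _ → both 2∣6 (∣-trans 2∣6 6∣b) , both 3∣6 (∣-trans 3∣6 6∣b))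
    where
    2∣6 : 2 ℕD.∣ 6
    2∣6 = divides 3 refl
    3∣6 : 3 ℕD.∣ 6
    3∣6 = divides 2 refl
  by-cases (yes 2∣n) (no 3∤n) = split-off 2 (s≤s (s≤s z≤n)) (not-exact⇒square 2∣n ¬2∥n)
    (λ 2∣b b∣n → both ℕD.∣-refl 2∣b , neither (from-no (3 ∣? 2)) (∤-divisor 3∤n b∣n))
  by-cases (no 2∤n) (yes 3∣n) = split-off 3 (s≤s (s≤s z≤n)) (not-exact⇒square 3∣n ¬3∥n)
    (λ 3∣b b∣n → neither (from-no (2 ∣? 3)) (∤-divisor 2∤n b∣n) , both ℕD.∣-refl 3∣b)
  by-cases (no 2∤n) (no 3∤n) =
    balanced n≡d*e (ℕ.nonTrivial⇒n>1 d) (cofactor≥2 n≢0 d<n n≡e*d)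
      (neither (∤-divisor 2∤n d∣n) (∤-divisor 2∤n e∣n))
      (neither (∤-divisor 3∤n d∣n) (∤-divisor 3∤n e∣n))
    where
    n≡d*e : n ≡ d ℕ.* e
    n≡d*e = trans n≡e*d (ℕP.*-comm e d)
    e∣n : e ℕD.∣ n
    e∣n = divides d n≡d*e

factorization-divisor : ∀ {m n x} → m ℕD.∣ n →
                        HasProperTauFactorization n x → HasProperTauFactorization m x
factorization-divisor m∣n (s , as , (sign , 1≤k , nonunits , pairwise , x≡) , 2≤k) =
  s , as , (sign , 1≤k , nonunits , All.map (All.map (∣-trans m∣n)) pairwise , x≡) , 2≤k

τ2∨τ3-atom⇒τ6-atom : ∀ x → IsTauAtom 2 x ⊎ IsTauAtom 3 x → IsTauAtom 6 x
τ2∨τ3-atom⇒τ6-atom x (inj₁ (nonunit , atomic)) = nonunit , atomic ∘ factorization-divisor (divides 3 refl)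
τ2∨τ3-atom⇒τ6-atom x (inj₂ (nonunit , atomic)) = nonunit , atomic ∘ factorization-divisor (divides 2 refl)

-- A τ₆-atom x is a τ₂-atom if 2 ∥ ∣x∣ and a τ₃-atom if 3 ∥ ∣x∣; otherwise
-- ∣x∣ cannot be composite (a balanced splitting would factor x), so x is
-- again a τ₂-atom.
τ6-atom⇒τ2∨τ3-atom : ∀ x → IsTauAtom 6 x → IsTauAtom 2 x ⊎ IsTauAtom 3 x
τ6-atom⇒τ2∨τ3-atom x (nonunit , atomic) with 2 ∥? ∣ x ∣ | 3 ∥? ∣ x ∣
... | yes (2∣x , 4∤x) | _  = inj₁ (nonunit , exact-prime⇒no-factorization x prime[2] 2∣x 4∤x)
... | no _ | yes (3∣x , 9∤x) = inj₂ (nonunit , exact-prime⇒no-factorization x (from-yes (prime? 3)) 3∣x 9∤x)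
... | no ¬2∥x | no ¬3∥x      = inj₁ (nonunit , noncomposite⇒no-factorization x
        (λ composite → atomic (balanced⇒factorization x (balanced-split ∣ x ∣ composite ¬2∥x ¬3∥x))))

theorem7 : (x : ℤ) → IsTauAtom 6 x ⇔ (IsTauAtom 2 x ⊎ IsTauAtom 3 x)
theorem7 x = mk⇔ (τ6-atom⇒τ2∨τ3-atom x) (τ2∨τ3-atom⇒τ6-atom x)
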